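{- Let $F:\mathbf{Set}\to\mathbf{Set}$ be any covariant functor and $X=(X_E,X_V)$ a pair of sets. Put $C(X):=(X_E\times FX_V,\ X_V,\ g_X)$ where $g_X:=\pi_{FX_V}:X_E\times FX_V\to FX_V$ is the projection, and $\varepsilon_X:=(\pi_{X_E},\mathrm{id}_{X_V}):(X_E\times FX_V,X_V)\to(X_E,X_V)$. Then for every $F$-graph $G=(E,V,g)$ and every pair of maps $\gamma=(\gamma_E,\gamma_V)$ with $\gamma_E:E\to X_E$, $\gamma_V:V\to X_V$, there exists a unique homomorphism $\bar\gamma:G\to C(X)$ with $\varepsilon_X\circ U(\bar\gamma)=\gamma$.
   Context: An $F$-graph is a triple $(E,V,g)$ with sets $E$, $V$ and a map $g:E\to FV$. A homomorphism $\phi:(E_1,V_1,g_1)\to(E_2,V_2,g_2)$ is a pair of maps $\phi_E:E_1\to E_2$, $\phi_V:V_1\to V_2$ with $g_2\circ\phi_E=F(\phi_V)\circ g_1$. $U$ denotes the forgetful functor $U(E,V,g)=(E,V)$, $U(\phi)=(\phi_E,\phi_V)$, to $\mathbf{Set}\times\mathbf{Set}$. -}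

module Defs where

open import Data.Product using (_×_; _,_; proj₁; proj₂)
open import Function using (id; _∘_)
open import Relation.Binary.PropositionalEquality using (_≡_)

-- A covariant endofunctor on Set (laws stated pointwise, no funext in Agda).
record Functor : Set₁ where
  field
    F₀     : Set → Set
    fmap   : {A B : Set} → (A → B) → F₀ A → F₀ B
    fmap-id : {A : Set} (x : F₀ A) → fmap id x ≡ x
    fmap-∘  : {A B C : Set} (f : B → C) (h : A → B) (x : F₀ A) →
              fmap (f ∘ h) x ≡ fmap f (fmap h x)
    -- F acts on maps as a function of maps (automatic with funext)
    fmap-cong : {A B : Set} {f h : A → B} → (∀ a → f a ≡ h a) →
                (x : F₀ A) → fmap f x ≡ fmap h x
open Functor public

record FGraph (F : Functor) : Set₁ where
  constructor fgraph
  field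
    E : Set
    V : Set
    g : E → F₀ F V
open FGraph public

record Hom {F : Functor} (G₁ G₂ : FGraph F) : Set where
  constructor hom
  field
    φE : E G₁ → E G₂
    φV : V G₁ → V G₂
    comm : ∀ e → g G₂ (φE e) ≡ fmap F φV (g G₁ e)
open Hom public

C : (F : Functor) → Set × Set → FGraph F
C F (XE , XV) = fgraph (XE × F₀ F XV) XV proj₂

εE : (F : Functor) (X : Set × Set) → E (C F X) → proj₁ X
εE F X = proj₁

εV : (F : Functor) (X : Set × Set) → V (C F X) → proj₂ X
εV F X = id

LiftOf : {F : Functor} {G : FGraph F} {X : Set × Set} →
         (E G → proj₁ X) → (V G → proj₂ X) → Hom G (C F X) → Set
LiftOf {F} {G} {X} γE γV φ =
  (∀ e → εE F X (φE φ e) ≡ γE e) × (∀ v → εV F X (φV φ v) ≡ γV v)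

_≗ₕ_ : {F : Functor} {G₁ G₂ : FGraph F} → Hom G₁ G₂ → Hom G₁ G₂ → Set
φ ≗ₕ ψ = (∀ e → φE φ e ≡ φE ψ e) × (∀ v → φV φ v ≡ φV ψ v)

module Submission where

open import Defs
open import Data.Product using (Σ; _×_; _,_; proj₁; proj₂)
open import Relation.Binary.PropositionalEquality using (_≡_; refl; trans; cong₂)

-- An edge of C(X) is a pair (label, F-image); the second component is forced by
-- the homomorphism condition, since g_X is the projection onto it.

module _ (F : Functor) (X : Set × Set) (G : FGraph F)
         (γE : E G → proj₁ X) (γV : V G → proj₂ X) where

  lift : Hom G (C F X)
  lift = hom (λ e → γE e , fmap F γV (g G e)) γV (λ _ → refl)

  lift-liftOf : LiftOf {F} {G} {X} γE γV lift
  lift-liftOf = (λ _ → refl) , (λ _ → refl)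

  liftOf-unique : (ψ : Hom G (C F X)) → LiftOf {F} {G} {X} γE γV ψ → ψ ≗ₕ lift
  liftOf-unique ψ (ψE≡γE , ψV≡γV) = edges , ψV≡γV
    where
    edges : ∀ e → φE ψ e ≡ φE lift e
    edges e = cong₂ _,_ (ψE≡γE e) (trans (comm ψ e) (fmap-cong F ψV≡γV (g G e)))

theorem7p1 : (F : Functor) (X : Set × Set) (G : FGraph F)
    (γE : E G → proj₁ X) (γV : V G → proj₂ X) →
    Σ (Hom G (C F X)) (λ γ̄ → LiftOf {F} {G} {X} γE γV γ̄ ×
    ((ψ : Hom G (C F X)) → LiftOf {F} {G} {X} γE γV ψ → ψ ≗ₕ γ̄))
theorem7p1 F X G γE γV =
  lift F X G γE γV , lift-liftOf F X G γE γV , liftOf-unique F X G γE γV
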